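{- Let $p,q$ be coprime positive integers and let $\mathcal B(p,q)=(a,b)$. Then: (1) $\mathcal B(q,p)=(q-b,\,p-a)$; (2) $\mathcal B(b+q,\,a+p)=(q,p)$.
   Context: For a pair of coprime positive integers $(p,q)$, the Bézout coefficients of $(p,q)$, denoted $\mathcal B(p,q)=(a,b)$, are the unique pair of integers such that $0<a\le p$, $0\le b<q$ and $aq-bp=1$. -}

module Defs where

open import Data.Nat using (ℕ; _+_; _*_; _≤_; _<_)
open import Data.Nat.Coprimality using (Coprime)
open import Data.Product using (_×_)
open import Relation.Binary.PropositionalEquality using (_≡_)

-- (a , b) are the Bézout coefficients of the coprime pair (p , q):
-- 0 < a ≤ p, 0 ≤ b < q and a q - b p = 1 (written in ℕ as a*q ≡ 1 + b*p).
-- Since these coefficients are unique, "𝓑(p,q) = (a,b)" is exactly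
-- "IsBezoutCoeffs p q a b" (with p, q positive and coprime).
IsBezoutCoeffs : ℕ → ℕ → ℕ → ℕ → Set
IsBezoutCoeffs p q a b =
  0 < p × 0 < q × Coprime p q ×
  0 < a × a ≤ p × b < q × a * q ≡ 1 + b * p

{-# OPTIONS --safe #-}
module Submission where

open import Defs
open import Data.Nat using (ℕ; _+_; _∸_; _*_; _≤_; _<_)
open import Data.Nat.Coprimality using (Coprime; Bézout-coprime)
import Data.Nat.Coprimality as Coprime
open import Data.Nat.GCD using (module Bézout)
open import Data.Nat.Properties
open import Data.Product using (_×_; _,_)
open import Relation.Binary.PropositionalEquality
open ≡-Reasoning

-- Reading  a q - b p = 1  as  q a' - p b' = 1  for (a', b') = (q - b, p - a) and
-- (a', b') = (a + p, b + q) gives both claims; the bounds are then immediate.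

bezout⇒coprime : ∀ {m n} x y → x * n ≡ 1 + y * m → Coprime m n
bezout⇒coprime {m} {n} x y xn≡1+ym = Bézout-coprime (Bézout.-+ y x identity)
  where
  identity : 1 + y * (m * 1) ≡ x * (n * 1)
  identity rewrite *-identityʳ m | *-identityʳ n = sym xn≡1+ym

bezout-swap : ∀ p q a b → a ≤ p → a * q ≡ 1 + b * p →
              (q ∸ b) * p ≡ 1 + (p ∸ a) * q
bezout-swap p q a b a≤p aq≡1+bp = begin
  (q ∸ b) * p                         ≡⟨ *-distribʳ-∸ p q b ⟩
  q * p ∸ b * p                       ≡⟨ cong (_∸ b * p) qp-split ⟩
  (p ∸ a) * q + (1 + b * p) ∸ b * p   ≡⟨ cong (_∸ b * p) (+-suc ((p ∸ a) * q) (b * p)) ⟩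
  1 + (p ∸ a) * q + b * p ∸ b * p     ≡⟨ m+n∸n≡m (1 + (p ∸ a) * q) (b * p) ⟩
  1 + (p ∸ a) * q                     ∎
  where
  qp-split : q * p ≡ (p ∸ a) * q + (1 + b * p)
  qp-split = begin
    q * p                   ≡⟨ *-comm q p ⟩
    p * q                   ≡⟨ cong (_* q) (sym (m∸n+n≡m a≤p)) ⟩
    (p ∸ a + a) * q         ≡⟨ *-distribʳ-+ q (p ∸ a) a ⟩
    (p ∸ a) * q + a * q     ≡⟨ cong ((p ∸ a) * q +_) aq≡1+bp ⟩
    (p ∸ a) * q + (1 + b * p) ∎

bezout-shift : ∀ p q a b → a * q ≡ 1 + b * p → q * (a + p) ≡ 1 + p * (b + q)
bezout-shift p q a b aq≡1+bp = begin
  q * (a + p)           ≡⟨ *-distribˡ-+ q a p ⟩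
  q * a + q * p         ≡⟨ cong₂ _+_ (*-comm q a) (*-comm q p) ⟩
  a * q + p * q         ≡⟨ cong (_+ p * q) aq≡1+bp ⟩
  1 + b * p + p * q     ≡⟨ cong (λ bp → 1 + bp + p * q) (*-comm b p) ⟩
  1 + p * b + p * q     ≡⟨ cong (1 +_) (sym (*-distribˡ-+ p b q)) ⟩
  1 + p * (b + q)       ∎

proposition1 : (p q a b : ℕ) → 0 < p → 0 < q → Coprime p q →
    IsBezoutCoeffs p q a b →
    IsBezoutCoeffs q p (q ∸ b) (p ∸ a) × IsBezoutCoeffs (b + q) (a + p) q p
proposition1 p q a b 0<p 0<q p⊥q (_ , _ , _ , 0<a , a≤p , b<q , aq≡1+bp) =
  ( 0<q , 0<p , Coprime.sym p⊥q
  , m<n⇒0<n∸m b<q , m∸n≤m q b , ∸-monoʳ-< 0<a a≤p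
  , bezout-swap p q a b a≤p aq≡1+bp )
  , ( <-≤-trans 0<q q≤b+q , <-≤-trans 0<p (m≤n+m p a) , bezout⇒coprime q p shifted
    , 0<q , q≤b+q , +-monoˡ-< p 0<a
    , shifted )
  where
  q≤b+q : q ≤ b + q
  q≤b+q = m≤n+m q b
  shifted : q * (a + p) ≡ 1 + p * (b + q)
  shifted = bezout-shift p q a b aq≡1+bp
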